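{- For every $C\subseteq[\mathbb{N}]^{<\omega}$, the set $C^*$ is smooth.
   Context: $[\mathbb{N}]^{<\omega}$ is the set of finite subsets of $\mathbb{N}$, identified with their increasing enumerations (finite sequences); $\mathrm{lh}(s)$ is the length of $s$, $s(i)$ its $(i+1)$-th element, $s[i]$ its initial segment of length $i$, and $t\sqsubseteq s$ ($t\sqsubset s$) means $t$ is a (proper) initial segment of $s$. For $s,t\in[\mathbb N]^{<\omega}$, $t\,\underline{\ll}\,s$ means $\mathrm{lh}(t)=\mathrm{lh}(s)$ and $t(i)\le s(i)$ for all $i<\mathrm{lh}(s)$. A set $C\subseteq[\mathbb{N}]^{<\omega}$ is smooth if for all $s,t\in C$ with $\mathrm{lh}(s)<\mathrm{lh}(t)$, $t[\mathrm{lh}(s)]\,\underline{\ll}\,s$ fails (i.e. $s(i)<t(i)$ for some $i<\mathrm{lh}(s)$). For $C\subseteq[\mathbb N]^{<\omega}$ let $A=\mathrm{base}(C)=\{n:\exists s\in C\;n\in s\}$ and define $T(C)=\{s\in[A]^{<\omega}:\forall t\sqsubseteq s\; t\notin C\}$, $T^*(C)=\{s\in[A]^{<\omega}:\exists t\in T(C)\; t\,\underline{\ll}\,s\}$, $C^*=\{s\in[A]^{<\omega}: s\notin T^*(C)\text{ and }\forall t\sqsubset s\; t\in T^*(C)\}$, where $[A]^{<\omega}$ is the set of finite subsets of $A$. -}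

module Defs where

open import Data.Nat using (ℕ; _≤_; _<_)
open import Data.List using (List; []; _∷_; _++_; length; take)
open import Data.List.Membership.Propositional using (_∈_)
open import Data.List.Relation.Unary.All using (All)
open import Data.List.Relation.Unary.Linked using (Linked)
open import Data.List.Relation.Binary.Pointwise using (Pointwise)
open import Data.Product using (Σ; ∃; _×_)
open import Relation.Binary.PropositionalEquality using (_≡_)
open import Relation.Nullary using (¬_)

-- Finite subsets of ℕ are represented by their increasing enumerations:
-- lists that are strictly increasing.
Increasing : List ℕ → Set
Increasing = Linked _<_

Family : Set₁
Family = List ℕ → Set

IsFamily : Family → Set
IsFamily C = ∀ s → C s → Increasing s

_⊑_ : List ℕ → List ℕ → Set
t ⊑ s = ∃ λ u → t ++ u ≡ s

_⊏_ : List ℕ → List ℕ → Set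
t ⊏ s = t ⊑ s × length t < length s

_≤≤_ : List ℕ → List ℕ → Set
t ≤≤ s = Pointwise _≤_ t s

Smooth : Family → Set
Smooth C = ∀ s t → C s → C t → length s < length t → ¬ (take (length s) t ≤≤ s)

base : Family → ℕ → Set
base C n = ∃ λ s → C s × n ∈ s

InA : Family → List ℕ → Set
InA C s = Increasing s × All (base C) s

T : Family → List ℕ → Set
T C s = InA C s × (∀ t → t ⊑ s → ¬ C t)

T* : Family → List ℕ → Set
T* C s = InA C s × (∃ λ t → T C t × t ≤≤ s)

_* : Family → Family
(C *) s = InA C s × ¬ T* C s × (∀ t → t ⊏ s → T* C t)

-- If s ∈ C* and t ∈ C* were a counterexample, the prefix u of t of length lh(s) is a proper
-- initial segment of t, hence lies in T*(C); since T*(C) is closed upwards under ≤≤ inside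
-- [A]^{<ω} and u ≤≤ s, also s ∈ T*(C), contradicting s ∈ C*.
module Submission where

open import Defs
open import Data.Nat using (ℕ; _<_)
open import Data.Nat.Properties using (≤-trans; <⇒≤; m≤n⇒m⊓n≡m)
open import Data.List using (List; length; take; drop)
open import Data.List.Properties using (take++drop≡id; length-take)
open import Data.List.Relation.Binary.Pointwise using (transitive)
open import Data.Product using (_,_)
open import Relation.Binary.PropositionalEquality using (subst; sym; trans)

take-⊏ : ∀ n (t : List ℕ) → n < length t → take n t ⊏ t
take-⊏ n t n<lt =
  (drop n t , take++drop≡id n t) ,
  subst (_< length t) (sym (trans (length-take n t) (m≤n⇒m⊓n≡m (<⇒≤ n<lt)))) n<lt

T*-≤≤-upward : ∀ C {u s} → InA C s → u ≤≤ s → T* C u → T* C s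
T*-≤≤-upward C s∈A u≤≤s (_ , w , w∈T , w≤≤u) = s∈A , w , w∈T , transitive ≤-trans w≤≤u u≤≤s

lemma3p6 : (C : Family) → IsFamily C → Smooth (C *)
lemma3p6 C _ s t (s∈A , s∉T* , _) (_ , _ , t-prefixes∈T*) ls<lt u≤≤s =
  s∉T* (T*-≤≤-upward C s∈A u≤≤s (t-prefixes∈T* _ (take-⊏ (length s) t ls<lt)))
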